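{- Let $k\in\mathbb{N}^+$, $m\in\mathbb{N}^+\cup\{\infty\}$, $q:=\lceil k/m\rceil$ (with $\lceil k/\infty\rceil:=1$), and $n\ge k+q$. Then $\mathcal{H}^m_{n,k}$ is maximal intersecting with respect to $\binom{[n]_m}{k}$.
   Context: $[n]_m$ is the multiset with exactly $m$ copies of each $i\in\{1,\dots,n\}$; a subset is $A=\{\mu_1\cdot1,\dots,\mu_n\cdot n\}$ with integers $0\le\mu_i\le m$ (unbounded if $m=\infty$), $|A|=\sum\mu_i$, $i\in A$ iff $\mu_i\ge1$, and $A\cap A'$ has multiplicities $\min\{\mu_i,\mu_i'\}$. $\binom{[n]_m}{k}$ is the family of subsets of $[n]_m$ of cardinality $k$. A family $\mathcal{A}\subseteq\binom{[n]_m}{k}$ is intersecting if any two members have nonempty intersection, and maximal intersecting with respect to $\binom{[n]_m}{k}$ if it is intersecting and for every $X\in\binom{[n]_m}{k}\setminus\mathcal{A}$ there is $A\in\mathcal{A}$ with $A\cap X=\emptyset$. Let $H=\{n-k+1,\dots,n\}$ (multiplicity one each), $\mathcal{E}^m_{n,k}=\{A\in\binom{[n]_m}{k}:1\in A\}$, and $\mathcal{H}^m_{n,k}=\{A\in\mathcal{E}^m_{n,k}:A\cap H\neq\emptyset\}\cup\{H\}$. -}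

module Defs where

open import Data.Nat using (ℕ; zero; suc; _+_; _∸_; _≤_; _≤?_; _/_)
open import Data.Fin using (Fin; toℕ)
open import Data.List using (List; map; allFin)
open import Data.Nat.ListAction using (sum)
open import Data.Unit using (⊤)
open import Data.Product using (Σ; _×_)
open import Data.Sum using (_⊎_)
open import Data.Bool using (if_then_else_)
open import Relation.Nullary using (¬_)
open import Relation.Nullary.Decidable using (⌊_⌋)
open import Relation.Binary.PropositionalEquality using (_≡_)

data Mult : Set where
  fin : ℕ → Mult
  ∞   : Mult

-- A sub-multiset of [n]_m is given by its multiplicity function μ : Fin n → ℕ;
-- index i : Fin n stands for the element (toℕ i + 1) ∈ {1,…,n}.
MSet : ℕ → Set
MSet n = Fin n → ℕ

Bounded : {n : ℕ} → Mult → MSet n → Set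
Bounded (fin m) A = ∀ i → A i ≤ m
Bounded ∞       A = ⊤

card : {n : ℕ} → MSet n → ℕ
card {n} A = sum (map A (allFin n))

InBinom : (n : ℕ) → Mult → ℕ → MSet n → Set
InBinom n m k A = Bounded m A × card A ≡ k

_∈ₘ_ : {n : ℕ} → ℕ → MSet n → Set
_∈ₘ_ {n} j A = Σ (Fin n) λ i → (toℕ i + 1 ≡ j) × (1 ≤ A i)

Meets : {n : ℕ} → MSet n → MSet n → Set
Meets {n} A B = Σ (Fin n) λ i → (1 ≤ A i) × (1 ≤ B i)

Family : ℕ → Set₁
Family n = MSet n → Set

Intersecting : {n : ℕ} → Family n → Set
Intersecting F = ∀ A B → F A → F B → Meets A B

MaximalIntersecting : (n : ℕ) → Mult → ℕ → Family n → Set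
MaximalIntersecting n m k F =
  (∀ A → F A → InBinom n m k A)
  × Intersecting F
  × (∀ X → InBinom n m k X → ¬ F X → Σ (MSet n) λ A → F A × ¬ Meets A X)

-- H = {n-k+1, …, n}, each with multiplicity one
Hset : (n k : ℕ) → MSet n
Hset n k i = if ⌊ n ∸ k ≤? toℕ i ⌋ then 1 else 0

EFam : (n : ℕ) → Mult → ℕ → Family n
EFam n m k A = InBinom n m k A × (1 ∈ₘ A)

HFam : (n : ℕ) → Mult → ℕ → Family n
HFam n m k A = (EFam n m k A × Meets A (Hset n k)) ⊎ (∀ i → A i ≡ Hset n k i)

Positive : Mult → Set
Positive (fin m) = 1 ≤ m
Positive ∞       = ⊤

-- q = ⌈k/m⌉, with ⌈k/∞⌉ = 1 (value for m = 0 is irrelevant)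
ceilDiv : ℕ → Mult → ℕ
ceilDiv k (fin zero)    = 0
ceilDiv k (fin (suc m)) = (k + m) / suc m
ceilDiv k ∞             = 1

-- Every member of the family contains 1 or is H, and contains a point of H, so the family
-- is intersecting.  For maximality let X be a k-set outside the family.  If X misses H, H is a
-- member disjoint from X.  Otherwise 1 ∉ X, and X ≠ H forces some h ∈ H \ X; as X also contains
-- a point of H, k ≥ 2.  The points outside X number at least n − k, and each can take
-- multiplicity up to m, giving room for m(n − k) ≥ m⌈k/m⌉ ≥ k elements: so a k-set through 1
-- and h can be placed entirely outside X, and it is a member of the family disjoint from X.
module Submission where

open import Defs
open import Data.Nat
open import Data.Nat.Properties
open import Data.Nat.DivMod using (m≡m%n+[m/n]*n; m%n<n)
import Data.Nat.ListAction as List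
open import Data.Fin using (Fin; zero; suc; toℕ)
open import Data.Fin.Properties using (any?)
open import Data.Vec.Functional using (Vector; _∷_)
open import Data.List using (tabulate)
open import Data.List.Properties using (map-tabulate)
open import Algebra.Properties.Semiring.Sum +-*-semiring
  using (sum; sum-cong-≗; sum-replicate-zero; ∑-distrib-+; *-distribˡ-sum)
open import Data.Bool using (if_then_else_)
open import Data.Unit using (tt)
open import Data.Product using (Σ; _×_; _,_; proj₂)
open import Data.Sum using (inj₁; inj₂)
open import Function using (_∘_)
open import Relation.Nullary using (¬_; yes; no; contradiction)
open import Relation.Nullary.Decidable using (⌊_⌋; _×-dec_)
open import Relation.Binary.PropositionalEquality

infix 4 _≤̇_

_≤̇_ : ∀ {n} → Vector ℕ n → Vector ℕ n → Set
f ≤̇ g = ∀ i → f i ≤ g i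

card≡sum : ∀ {n} (A : MSet n) → card A ≡ sum A
card≡sum A = trans (cong List.sum (map-tabulate (λ i → i) A)) (listSum-tabulate A)
  where
    listSum-tabulate : ∀ {n} (f : Vector ℕ n) → List.sum (tabulate f) ≡ sum f
    listSum-tabulate {zero}  f = refl
    listSum-tabulate {suc n} f = cong (f zero +_) (listSum-tabulate (f ∘ suc))

sum-ones : ∀ n → sum {n} (λ _ → 1) ≡ n
sum-ones zero    = refl
sum-ones (suc n) = cong suc (sum-ones n)

sum-mono-≤ : ∀ {n} {f g : Vector ℕ n} → f ≤̇ g → sum f ≤ sum g
sum-mono-≤ {zero}  f≤g = z≤n
sum-mono-≤ {suc n} f≤g = +-mono-≤ (f≤g zero) (sum-mono-≤ (f≤g ∘ suc))

≤̇∧sum≡⇒≗ : ∀ {n} {f g : Vector ℕ n} → f ≤̇ g → sum f ≡ sum g → ∀ i → f i ≡ g i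
≤̇∧sum≡⇒≗ {suc n} {f} {g} f≤g Σf≡Σg = pointwise
  where
    head≡ : f zero ≡ g zero
    head≡ = ≤-antisym (f≤g zero) (+-cancelʳ-≤ (sum (f ∘ suc)) (g zero) (f zero)
      (≤-trans (+-monoʳ-≤ (g zero) (sum-mono-≤ (f≤g ∘ suc))) (≤-reflexive (sym Σf≡Σg))))
    tail≡ : sum (f ∘ suc) ≡ sum (g ∘ suc)
    tail≡ = +-cancelˡ-≡ (g zero) _ _ (trans (cong (_+ sum (f ∘ suc)) (sym head≡)) Σf≡Σg)
    pointwise : ∀ i → f i ≡ g i
    pointwise zero    = head≡
    pointwise (suc i) = ≤̇∧sum≡⇒≗ (f≤g ∘ suc) tail≡ i

entry≤sum : ∀ {n} (f : Vector ℕ n) i → f i ≤ sum f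
entry≤sum f zero    = m≤m+n (f zero) _
entry≤sum f (suc i) = ≤-trans (entry≤sum (f ∘ suc) i) (m≤n+m _ (f zero))

1≤sum⇒∃1≤ : ∀ {n} (f : Vector ℕ n) → 1 ≤ sum f → Σ (Fin n) λ i → 1 ≤ f i
1≤sum⇒∃1≤ {zero}  f ()
1≤sum⇒∃1≤ {suc n} f 1≤Σf with f zero ≟ 0
... | no  f0≢0 = zero , n≢0⇒n>0 f0≢0
... | yes f0≡0 with 1≤sum⇒∃1≤ (f ∘ suc) (subst (λ x → 1 ≤ x + sum (f ∘ suc)) f0≡0 1≤Σf)
...   | i , 1≤fi = suc i , 1≤fi

two-entries≤sum : ∀ {n} (f : Vector ℕ n) {i j} → i ≢ j → 1 ≤ f i → 1 ≤ f j → 2 ≤ sum f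
two-entries≤sum f {zero}  {zero}  i≢j _ _ = contradiction refl i≢j
two-entries≤sum f {zero}  {suc j} _ 1≤fi 1≤fj = +-mono-≤ 1≤fi (≤-trans 1≤fj (entry≤sum (f ∘ suc) j))
two-entries≤sum f {suc i} {zero}  _ 1≤fi 1≤fj = +-mono-≤ 1≤fj (≤-trans 1≤fi (entry≤sum (f ∘ suc) i))
two-entries≤sum f {suc i} {suc j} i≢j 1≤fi 1≤fj =
  ≤-trans (two-entries≤sum (f ∘ suc) (i≢j ∘ cong suc) 1≤fi 1≤fj) (m≤n+m _ (f zero))

fill : ∀ {n} (c : Vector ℕ n) r → r ≤ sum c → Σ (Vector ℕ n) λ A → A ≤̇ c × sum A ≡ r
fill {zero}  c zero    _    = c , (λ ()) , refl
fill {suc n} c r       r≤Σc with fill (c ∘ suc) (r ∸ c zero) (m≤n+o⇒m∸n≤o r (c zero) r≤Σc)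
... | A , A≤c , ΣA = (c zero ⊓ r) ∷ A , (λ { zero → m⊓n≤m _ _ ; (suc i) → A≤c i })
                   , trans (cong (c zero ⊓ r +_) ΣA) (m⊓n+n∸m≡n (c zero) r)

sandwich : ∀ {n} {L c : Vector ℕ n} {r} → L ≤̇ c → sum L ≤ r → r ≤ sum c
  → Σ (Vector ℕ n) λ A → L ≤̇ A × A ≤̇ c × sum A ≡ r
sandwich {L = L} {c} {r} L≤c ΣL≤r r≤Σc with fill (λ i → c i ∸ L i) (r ∸ sum L) room
  where
    Σc≡ : sum c ≡ sum L + sum (λ i → c i ∸ L i)
    Σc≡ = trans (sum-cong-≗ (λ i → sym (m∸n+n≡m (L≤c i))))
                (trans (∑-distrib-+ _ L) (+-comm _ (sum L)))
    room : r ∸ sum L ≤ sum (λ i → c i ∸ L i)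
    room = m≤n+o⇒m∸n≤o r (sum L) (≤-trans r≤Σc (≤-reflexive Σc≡))
... | F , F≤c∸L , ΣF = (λ i → F i + L i)
  , (λ i → m≤n+m (L i) (F i))
  , (λ i → ≤-trans (+-monoˡ-≤ (L i) (F≤c∸L i)) (≤-reflexive (m∸n+n≡m (L≤c i))))
  , trans (∑-distrib-+ F L) (trans (cong (_+ sum L) ΣF) (m∸n+n≡m ΣL≤r))

δ : ∀ {n} → Fin n → Vector ℕ n
δ zero    zero    = 1
δ zero    (suc i) = 0
δ (suc h) zero    = 0
δ (suc h) (suc i) = δ h i

δ-self : ∀ {n} (h : Fin n) → δ h h ≡ 1
δ-self zero    = refl
δ-self (suc h) = δ-self h

sum-δ : ∀ {n} (h : Fin n) → sum (δ h) ≡ 1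
sum-δ {suc n} zero    = cong suc (sum-replicate-zero n)
sum-δ {suc n} (suc h) = sum-δ h

δ≤̇ : ∀ {n} {f : Vector ℕ n} h → 1 ≤ f h → δ h ≤̇ f
δ≤̇ zero    1≤fh zero    = 1≤fh
δ≤̇ zero    _    (suc i) = z≤n
δ≤̇ (suc h) _    zero    = z≤n
δ≤̇ (suc h) 1≤fh (suc i) = δ≤̇ h 1≤fh i

-- Hset n k i is definitionally ⟦ n ∸ k ≤ toℕ i ⟧.
⟦_≤_⟧ : ℕ → ℕ → ℕ
⟦ t ≤ x ⟧ = if ⌊ t ≤? x ⌋ then 1 else 0

⟦≤⟧-true : ∀ {t x} → t ≤ x → ⟦ t ≤ x ⟧ ≡ 1
⟦≤⟧-true {t} {x} t≤x with t ≤? x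
... | yes _   = refl
... | no  t≰x = contradiction t≤x t≰x

⟦≤⟧-false : ∀ {t x} → ¬ t ≤ x → ⟦ t ≤ x ⟧ ≡ 0
⟦≤⟧-false {t} {x} t≰x with t ≤? x
... | yes t≤x = contradiction t≤x t≰x
... | no  _   = refl

⟦≤⟧≤1 : ∀ t x → ⟦ t ≤ x ⟧ ≤ 1
⟦≤⟧≤1 t x with t ≤? x
... | yes _ = s≤s z≤n
... | no  _ = z≤n

⟦≤⟧-suc : ∀ t x → ⟦ suc t ≤ suc x ⟧ ≡ ⟦ t ≤ x ⟧
⟦≤⟧-suc t x with t ≤? x
... | yes t≤x = ⟦≤⟧-true (s≤s t≤x)
... | no  t≰x = ⟦≤⟧-false (t≰x ∘ s≤s⁻¹)

sum-⟦≤toℕ⟧ : ∀ n t → sum {n} (λ i → ⟦ t ≤ toℕ i ⟧) ≡ n ∸ t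
sum-⟦≤toℕ⟧ zero    t       = sym (0∸n≡0 t)
sum-⟦≤toℕ⟧ (suc n) zero    = cong suc (sum-⟦≤toℕ⟧ n zero)
sum-⟦≤toℕ⟧ (suc n) (suc t) =
  trans (sum-cong-≗ {n} (λ i → ⟦≤⟧-suc t (toℕ i))) (sum-⟦≤toℕ⟧ n t)

n∸sum≤#empty : ∀ {n} (X : Vector ℕ n) → n ∸ sum X ≤ sum (λ i → ⟦ X i ≤ 0 ⟧)
n∸sum≤#empty {n} X = m≤n+o⇒m∸n≤o n (sum X) (begin
  n                                           ≡⟨ sum-ones n ⟨
  sum {n} (λ _ → 1)                           ≤⟨ sum-mono-≤ (λ i → occupiedOrEmpty (X i)) ⟩
  sum (λ i → X i + ⟦ X i ≤ 0 ⟧)               ≡⟨ ∑-distrib-+ X _ ⟩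
  sum X + sum (λ i → ⟦ X i ≤ 0 ⟧)             ∎)
  where
    open ≤-Reasoning
    occupiedOrEmpty : ∀ x → 1 ≤ x + ⟦ x ≤ 0 ⟧
    occupiedOrEmpty zero    = s≤s z≤n
    occupiedOrEmpty (suc x) = s≤s z≤n

avoiding-through : ∀ {n M k} (X : Vector ℕ n) (p q : Fin n) → X p ≡ 0 → X q ≡ 0
  → 1 ≤ M → 2 ≤ k → k ≤ M * (n ∸ sum X)
  → Σ (Vector ℕ n) λ A → A ≤̇ (λ _ → M) × sum A ≡ k × 1 ≤ A p × 1 ≤ A q × ¬ Meets A X
avoiding-through {n} {M} {k} X p q Xp≡0 Xq≡0 1≤M 2≤k k≤room = conclude (sandwich L≤c ΣL≤k k≤Σc)
  where
    open ≤-Reasoning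
    c : Vector ℕ n
    c i = M * ⟦ X i ≤ 0 ⟧
    L : Vector ℕ n
    L i = δ p i ⊔ δ q i
    empty⇒1≤c : ∀ {i} → X i ≡ 0 → 1 ≤ c i
    empty⇒1≤c Xi≡0 rewrite Xi≡0 = ≤-trans 1≤M (≤-reflexive (sym (*-identityʳ M)))
    occupied⇒c≡0 : ∀ {i} → 1 ≤ X i → c i ≡ 0
    occupied⇒c≡0 {i} 1≤Xi with X i
    ... | suc _ = *-zeroʳ M
    L≤c : L ≤̇ c
    L≤c i = ⊔-lub (δ≤̇ p (empty⇒1≤c Xp≡0) i) (δ≤̇ q (empty⇒1≤c Xq≡0) i)
    ΣL≤k : sum L ≤ k
    ΣL≤k = begin
      sum L                         ≤⟨ sum-mono-≤ (λ i → m⊔n≤m+n (δ p i) (δ q i)) ⟩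
      sum (λ i → δ p i + δ q i)     ≡⟨ ∑-distrib-+ (δ p) (δ q) ⟩
      sum (δ p) + sum (δ q)         ≡⟨ cong₂ _+_ (sum-δ p) (sum-δ q) ⟩
      2                             ≤⟨ 2≤k ⟩
      k                             ∎
    k≤Σc : k ≤ sum c
    k≤Σc = begin
      k                             ≤⟨ k≤room ⟩
      M * (n ∸ sum X)               ≤⟨ *-monoʳ-≤ M (n∸sum≤#empty X) ⟩
      M * sum (λ i → ⟦ X i ≤ 0 ⟧)   ≡⟨ *-distribˡ-sum M (λ i → ⟦ X i ≤ 0 ⟧) ⟩
      sum c                         ∎
    conclude : Σ (Vector ℕ n) (λ A → L ≤̇ A × A ≤̇ c × sum A ≡ k)
      → Σ (Vector ℕ n) λ A → A ≤̇ (λ _ → M) × sum A ≡ k × 1 ≤ A p × 1 ≤ A q × ¬ Meets A X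
    conclude (A , L≤A , A≤c , ΣA≡k) =
      A , A≤M , ΣA≡k , through p (m≤m⊔n _ _) , through q (m≤n⊔m _ _) , disjoint
      where
        A≤M : A ≤̇ (λ _ → M)
        A≤M i = ≤-trans (A≤c i) (≤-trans (*-monoʳ-≤ M (⟦≤⟧≤1 (X i) 0)) (≤-reflexive (*-identityʳ M)))
        through : ∀ h → δ h h ≤ L h → 1 ≤ A h
        through h δ≤L = ≤-trans (≤-reflexive (sym (δ-self h))) (≤-trans δ≤L (L≤A h))
        disjoint : ¬ Meets A X
        disjoint (i , 1≤Ai , 1≤Xi) with () ← subst (1 ≤_) (occupied⇒c≡0 1≤Xi) (≤-trans 1≤Ai (A≤c i))

-- The multiplicity cap for building members: m itself, or k when m = ∞ (Bounded ∞ is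
-- vacuous, and no element of a k-set needs more than k copies).
bound : Mult → ℕ → ℕ
bound (fin m) k = m
bound ∞       k = k

Bounded-≤bound : ∀ m k {n} {A : MSet n} → A ≤̇ (λ _ → bound m k) → Bounded m A
Bounded-≤bound (fin m) k A≤m = A≤m
Bounded-≤bound ∞       k _   = tt

1≤bound : ∀ m {k} → Positive m → 1 ≤ k → 1 ≤ bound m k
1≤bound (fin m) 1≤m _   = 1≤m
1≤bound ∞       _   1≤k = 1≤k

k≤ceilDiv*m : ∀ k m → k ≤ ceilDiv k (fin (suc m)) * suc m
k≤ceilDiv*m k m = +-cancelʳ-≤ m k (q * suc m) (begin
  k + m                       ≡⟨ m≡m%n+[m/n]*n (k + m) (suc m) ⟩
  (k + m) % suc m + q * suc m ≤⟨ +-monoˡ-≤ (q * suc m) (s≤s⁻¹ (m%n<n (k + m) (suc m))) ⟩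
  m + q * suc m               ≡⟨ +-comm m (q * suc m) ⟩
  q * suc m + m               ∎)
  where
    open ≤-Reasoning
    q = ceilDiv k (fin (suc m))

m+n≤o⇒n≤o∸m : ∀ m {n o} → m + n ≤ o → n ≤ o ∸ m
m+n≤o⇒n≤o∸m m {n} {o} m+n≤o = m+n≤o⇒m≤o∸n n (subst (_≤ o) (+-comm m n) m+n≤o)

k≤bound*[n∸k] : ∀ {k} m {n} → Positive m → 1 ≤ k → k + ceilDiv k m ≤ n → k ≤ bound m k * (n ∸ k)
k≤bound*[n∸k] {k} (fin (suc m)) _ _ k+q≤n = ≤-trans (k≤ceilDiv*m k m)
  (≤-trans (≤-reflexive (*-comm _ (suc m))) (*-monoʳ-≤ (suc m) (m+n≤o⇒n≤o∸m k k+q≤n)))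
k≤bound*[n∸k] {k} ∞ _ _ k+1≤n =
  ≤-trans (≤-reflexive (sym (*-identityʳ k))) (*-monoʳ-≤ k (m+n≤o⇒n≤o∸m k k+1≤n))

Meets-sym : ∀ {n} {A B : MSet n} → Meets A B → Meets B A
Meets-sym (i , 1≤Ai , 1≤Bi) = i , 1≤Bi , 1≤Ai

Meets-respʳ : ∀ {n} {A B C : MSet n} → (∀ i → B i ≡ C i) → Meets A B → Meets A C
Meets-respʳ B≗C (i , 1≤Ai , 1≤Bi) = i , 1≤Ai , subst (1 ≤_) (B≗C i) 1≤Bi

meets-at-1 : ∀ {n} {A B : MSet n} → 1 ∈ₘ A → 1 ∈ₘ B → Meets A B
meets-at-1 (zero  , _ , 1≤A0) (zero  , _ , 1≤B0) = zero , 1≤A0 , 1≤B0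
meets-at-1 (zero  , _ , _)    (suc i , e , _)    = contradiction (suc-injective e) (m+1+n≢0 (toℕ i))
meets-at-1 (suc i , e , _)    _                  = contradiction (suc-injective e) (m+1+n≢0 (toℕ i))

∈Hset : ∀ n k {i : Fin n} → n ∸ k ≤ toℕ i → 1 ≤ Hset n k i
∈Hset _ _ i∈H = ≤-reflexive (sym (⟦≤⟧-true i∈H))

sum-Hset : ∀ {n k} → k ≤ n → sum (Hset n k) ≡ k
sum-Hset {n} {k} k≤n = trans (sum-⟦≤toℕ⟧ n (n ∸ k)) (m∸[m∸n]≡n k≤n)

HFam⇒InBinom : ∀ {n m k} {A : MSet n} → Positive m → 1 ≤ k → k ≤ n → HFam n m k A → InBinom n m k A
HFam⇒InBinom _ _ _ (inj₁ ((A∈ , _) , _)) = A∈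
HFam⇒InBinom {n} {m} {k} {A} m>0 1≤k k≤n (inj₂ A≗H) =
  Bounded-≤bound m k (λ i → ≤-trans (≤-reflexive (A≗H i)) (≤-trans (⟦≤⟧≤1 _ _) (1≤bound m m>0 1≤k)))
  , trans (card≡sum A) (trans (sum-cong-≗ {n} A≗H) (sum-Hset k≤n))

HFam-meets-Hset : ∀ {n m k} {A : MSet n} → 1 ≤ k → k ≤ n → HFam n m k A → Meets A (Hset n k)
HFam-meets-Hset _ _ (inj₁ (_ , A∩H)) = A∩H
HFam-meets-Hset {n} {m} {k} 1≤k k≤n (inj₂ A≗H)
  with i , 1≤Hi ← 1≤sum⇒∃1≤ (Hset n k) (subst (1 ≤_) (sym (sum-Hset k≤n)) 1≤k)
  = i , subst (1 ≤_) (sym (A≗H i)) 1≤Hi , 1≤Hi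

HFam-intersecting : ∀ {n m k} → 1 ≤ k → k ≤ n → Intersecting (HFam n m k)
HFam-intersecting _ _ A B (inj₁ ((_ , 1∈A) , _)) (inj₁ ((_ , 1∈B) , _)) = meets-at-1 1∈A 1∈B
HFam-intersecting 1≤k k≤n A B A∈ (inj₂ B≗H) =
  Meets-respʳ (sym ∘ B≗H) (HFam-meets-Hset 1≤k k≤n A∈)
HFam-intersecting 1≤k k≤n A B (inj₂ A≗H) B∈ =
  Meets-sym (Meets-respʳ (sym ∘ A≗H) (HFam-meets-Hset 1≤k k≤n B∈))

HFam-separates : ∀ {n m k} → Positive m → 1 ≤ k → k + ceilDiv k m ≤ suc n
  → ∀ X → InBinom (suc n) m k X → Meets X (Hset (suc n) k) → X zero ≡ 0
  → ∀ h → suc n ∸ k ≤ toℕ h → X h ≡ 0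
  → Σ (MSet (suc n)) λ A → HFam (suc n) m k A × ¬ Meets A X
HFam-separates {n} {m} {k} m>0 1≤k k+q≤n X (_ , cardX≡k) (j , 1≤Xj , 1≤Hj) X0≡0 h h∈H Xh≡0 =
  member (avoiding-through X zero h X0≡0 Xh≡0 (1≤bound m m>0 1≤k) 2≤k k≤room)
  where
    ΣX≡k : sum X ≡ k
    ΣX≡k = trans (sym (card≡sum X)) cardX≡k
    j≢h : j ≢ h
    j≢h refl = contradiction (subst (1 ≤_) Xh≡0 1≤Xj) λ ()
    2≤k : 2 ≤ k
    2≤k = subst (2 ≤_) (sum-Hset (m+n≤o⇒m≤o k k+q≤n))
      (two-entries≤sum (Hset (suc n) k) j≢h 1≤Hj (∈Hset (suc n) k h∈H))
    k≤room : k ≤ bound m k * (suc n ∸ sum X)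
    k≤room = subst (λ s → k ≤ bound m k * (suc n ∸ s)) (sym ΣX≡k) (k≤bound*[n∸k] m m>0 1≤k k+q≤n)
    member : Σ (MSet (suc n)) (λ A → A ≤̇ (λ _ → bound m k) × sum A ≡ k
                                     × 1 ≤ A zero × 1 ≤ A h × ¬ Meets A X)
      → Σ (MSet (suc n)) λ A → HFam (suc n) m k A × ¬ Meets A X
    member (A , A≤M , ΣA≡k , 1≤A0 , 1≤Ah , A∩X≡∅) =
      A , inj₁ (((Bounded-≤bound m k A≤M , trans (card≡sum A) ΣA≡k) , zero , refl , 1≤A0)
               , h , 1≤Ah , ∈Hset (suc n) k h∈H)
        , A∩X≡∅

HFam-maximal : ∀ {n m k} → Positive m → 1 ≤ k → k + ceilDiv k m ≤ suc n
  → ∀ X → InBinom (suc n) m k X → ¬ HFam (suc n) m k X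
  → Σ (MSet (suc n)) λ A → HFam (suc n) m k A × ¬ Meets A X
HFam-maximal {n} {m} {k} m>0 1≤k k+q≤n X X∈ X∉
  with any? (λ i → (1 ≤? X i) ×-dec (1 ≤? Hset (suc n) k i))
... | no  X∩H≡∅ = Hset (suc n) k , inj₂ (λ _ → refl) , X∩H≡∅ ∘ Meets-sym
... | yes X∩H with X zero ≟ 0
...   | no  X0≢0 = contradiction (inj₁ ((X∈ , zero , refl , n≢0⇒n>0 X0≢0) , X∩H)) X∉
...   | yes X0≡0 with any? (λ i → (suc n ∸ k ≤? toℕ i) ×-dec (X i ≟ 0))
...     | yes (h , h∈H , Xh≡0) = HFam-separates m>0 1≤k k+q≤n X X∈ X∩H X0≡0 h h∈H Xh≡0
...     | no  H⊆X = contradiction (inj₂ X≗H) X∉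
  where
    H≤X : Hset (suc n) k ≤̇ X
    H≤X i with suc n ∸ k ≤? toℕ i
    ... | yes i∈H = n≢0⇒n>0 λ Xi≡0 → H⊆X (i , i∈H , Xi≡0)
    ... | no  _   = z≤n
    X≗H : ∀ i → X i ≡ Hset (suc n) k i
    X≗H i = sym (≤̇∧sum≡⇒≗ H≤X (trans (sum-Hset (m+n≤o⇒m≤o k k+q≤n))
      (trans (sym (proj₂ X∈)) (card≡sum X))) i)

lemma3p4 : (k : ℕ) → 1 ≤ k → (m : Mult) → Positive m → (n : ℕ)
    → k + ceilDiv k m ≤ n
    → MaximalIntersecting n m k (HFam n m k)
lemma3p4 k 1≤k m m>0 zero    k+q≤0 = contradiction (≤-trans 1≤k (m+n≤o⇒m≤o k k+q≤0)) λ ()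
lemma3p4 k 1≤k m m>0 (suc n) k+q≤n =
  (λ _ → HFam⇒InBinom m>0 1≤k k≤n) , HFam-intersecting 1≤k k≤n , HFam-maximal m>0 1≤k k+q≤n
  where
    k≤n : k ≤ suc n
    k≤n = m+n≤o⇒m≤o k k+q≤n
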